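{- For every positive integer $n$, $n \ge 3\delta(n)$.
   Context: Let $\mathcal H$ be the set of positive integers $h$ for which a Hadamard matrix of order $h$ exists (an $h\times h$ matrix with entries in $\{+1,-1\}$ and absolute determinant $h^{h/2}$). Define $\delta(n) := \min_{h\in\mathcal H}|n-h|$. -}

module Defs where

open import Data.Nat as ℕ using (ℕ; zero; suc; _≤_; ∣_-_∣)
open import Data.Integer as ℤ using (ℤ; +_; -[1+_]; ∣_∣)
open import Data.Fin using (Fin; zero; suc; punchIn)
open import Data.Product using (Σ; _×_)
open import Data.Sum using (_⊎_)
open import Relation.Binary.PropositionalEquality using (_≡_)

Matrix : ℕ → Set
Matrix n = Fin n → Fin n → ℤ

sumFin : ∀ n → (Fin n → ℤ) → ℤ
sumFin zero    f = + 0
sumFin (suc n) f = f zero ℤ.+ sumFin n (λ i → f (suc i))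

altSign : ℕ → ℤ
altSign zero          = + 1
altSign (suc zero)    = -[1+ 0 ]
altSign (suc (suc k)) = altSign k

det : ∀ n → Matrix n → ℤ
det zero    M = + 1
det (suc n) M =
  sumFin (suc n) (λ j →
    altSign (Data.Fin.toℕ j) ℤ.* M zero j ℤ.* det n (λ r c → M (suc r) (punchIn j c)))

-- Hadamard matrix of order h: ±1 entries and |det M| = h^(h/2),
-- expressed (equivalently, avoiding half-integer exponents) as |det M|^2 = h^h.
IsHadamardMatrix : ∀ h → Matrix h → Set
IsHadamardMatrix h M =
  (∀ i j → (M i j ≡ + 1) ⊎ (M i j ≡ -[1+ 0 ]))
  × (∣ det h M ∣ ℕ.* ∣ det h M ∣ ≡ h ℕ.^ h)

InH : ℕ → Set
InH h = (1 ≤ h) × Σ (Matrix h) (IsHadamardMatrix h)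

IsDelta : ℕ → ℕ → Set
IsDelta n d = Σ ℕ (λ h → InH h × ∣ n - h ∣ ≡ d) × (∀ h → InH h → d ≤ ∣ n - h ∣)

module Submission where

-- Every power of two is such an order (Sylvester's construction), and if
-- 2^k ≤ n < 2^(k+1) then one of 2^k, 2^(k+1) lies within n/3 of n.

open import Defs

module SylvesterHadamard where
  open import Data.Nat as ℕ using (ℕ; zero; suc)
  open import Data.Integer using (ℤ; +_; -[1+_]; -1ℤ; _+_; _*_; -_; _^_; ∣_∣)
  import Data.Integer.Properties as ℤP
  open import Data.Integer.Tactic.RingSolver using (solve-∀)
  import Data.Nat.Properties as ℕP
  import Data.Nat.Tactic.RingSolver as ℕS
  open import Data.Bool using (if_then_else_)
  open import Data.Fin
    using (Fin; zero; suc; toℕ; fromℕ<; punchIn; punchOut; _≟_; _↑ˡ_; _↑ʳ_; splitAt; join)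
  import Data.Fin.Properties as FinP
  open import Algebra.Properties.Semiring.Sum ℤP.+-*-semiring
    using ( sum; sum-cong-≗; sum-replicate-zero; sum-remove; ∑-comm; ∑-distrib-+
          ; *-distribˡ-sum; *-distribʳ-sum)
  open import Algebra.Properties.AbelianGroup ℤP.+-0-abelianGroup using (∙-cancelˡ)
  open import Data.Product using (_,_)
  open import Data.Sum using (_⊎_; inj₁; inj₂; [_,_]′)
  open import Relation.Nullary using (¬_; yes; no; does)
  open import Relation.Nullary.Decidable using (dec-true; dec-false)
  open import Data.Empty using (⊥-elim)
  open import Function using (_∘_; id)
  open import Relation.Binary.PropositionalEquality

  sumFin≡sum : ∀ n (f : Fin n → ℤ) → sumFin n f ≡ sum f
  sumFin≡sum zero    f = refl
  sumFin≡sum (suc n) f = cong (_+_ (f zero)) (sumFin≡sum n (λ i → f (suc i)))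

  sum-zero : ∀ n {f : Fin n → ℤ} → (∀ i → f i ≡ + 0) → sum f ≡ + 0
  sum-zero n f≗0 = trans (sum-cong-≗ f≗0) (sum-replicate-zero n)

  sum-neg : ∀ {n} (f : Fin n → ℤ) → sum (λ i → - f i) ≡ - sum f
  sum-neg f = begin
      sum (λ i → - f i)     ≡⟨ sum-cong-≗ (λ i → sym (ℤP.-1*i≡-i (f i))) ⟩
      sum (λ i → -1ℤ * f i) ≡⟨ sym (*-distribˡ-sum -1ℤ f) ⟩
      -1ℤ * sum f           ≡⟨ ℤP.-1*i≡-i (sum f) ⟩
      - sum f               ∎
    where open ≡-Reasoning

  -- A sum over ordered pairs (a , b) with a ≠ b, each such pair enumerated as
  -- (a , punchIn a k), is unchanged when the two coordinates are exchanged: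
  -- both are the full double sum minus the diagonal.
  sum-offDiagonal-transpose : ∀ m (G : Fin (suc m) → Fin (suc m) → ℤ) →
    sum (λ a → sum (λ k → G a (punchIn a k))) ≡ sum (λ a → sum (λ k → G (punchIn a k) a))
  sum-offDiagonal-transpose m G = ∙-cancelˡ diagonal _ _ (begin
      diagonal + sum (λ a → sum (λ k → G a (punchIn a k)))
    ≡⟨ sym (∑-distrib-+ (λ a → G a a) (λ a → sum (λ k → G a (punchIn a k)))) ⟩
      sum (λ a → G a a + sum (λ k → G a (punchIn a k)))
    ≡⟨ sum-cong-≗ (λ a → sym (sum-remove {i = a} (G a))) ⟩
      sum (λ a → sum (λ b → G a b))
    ≡⟨ ∑-comm G ⟩
      sum (λ b → sum (λ a → G a b))
    ≡⟨ sum-cong-≗ (λ b → sum-remove {i = b} (λ a → G a b)) ⟩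
      sum (λ b → G b b + sum (λ k → G (punchIn b k) b))
    ≡⟨ ∑-distrib-+ (λ b → G b b) (λ b → sum (λ k → G (punchIn b k) b)) ⟩
      diagonal + sum (λ b → sum (λ k → G (punchIn b k) b))
    ∎)
    where
    open ≡-Reasoning
    diagonal : ℤ
    diagonal = sum (λ a → G a a)

  minor : ∀ {n} → Matrix (suc n) → Fin (suc n) → Matrix n
  minor M j r c = M (suc r) (punchIn j c)

  laplaceTerm : ∀ {n} → Matrix (suc n) → Fin (suc n) → ℤ
  laplaceTerm {n} M j = altSign (toℕ j) * M zero j * det n (minor M j)

  det-laplace : ∀ n (M : Matrix (suc n)) → det (suc n) M ≡ sum (laplaceTerm M)
  det-laplace n M = sumFin≡sum (suc n) (laplaceTerm M)

  det-cong : ∀ n {M N : Matrix n} → (∀ i j → M i j ≡ N i j) → det n M ≡ det n N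
  det-cong zero    eq = refl
  det-cong (suc n) {M} {N} eq =
    trans (det-laplace n M) (trans (sum-cong-≗ sameTerms) (sym (det-laplace n N)))
    where
    sameTerms : ∀ j → laplaceTerm M j ≡ laplaceTerm N j
    sameTerms j = cong₂ (λ x d → altSign (toℕ j) * x * d)
                        (eq zero j) (det-cong n (λ r c → eq (suc r) (punchIn j c)))

  det-scale : ∀ n c (A : Matrix n) → det n (λ i j → c * A i j) ≡ c ^ n * det n A
  det-scale zero    c A = refl
  det-scale (suc n) c A = begin
      det (suc n) (λ i j → c * A i j)
    ≡⟨ det-laplace n (λ i j → c * A i j) ⟩
      sum (λ j → altSign (toℕ j) * (c * A zero j) * det n (λ r k → c * minor A j r k))
    ≡⟨ sum-cong-≗ (λ j → cong (λ d → altSign (toℕ j) * (c * A zero j) * d)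
                              (det-scale n c (minor A j))) ⟩
      sum (λ j → altSign (toℕ j) * (c * A zero j) * (c ^ n * det n (minor A j)))
    ≡⟨ sum-cong-≗ (λ j → regroup (altSign (toℕ j)) c (A zero j) (c ^ n) (det n (minor A j))) ⟩
      sum (λ j → c ^ suc n * laplaceTerm A j)
    ≡⟨ sym (*-distribˡ-sum (c ^ suc n) (laplaceTerm A)) ⟩
      c ^ suc n * sum (laplaceTerm A)
    ≡⟨ cong (c ^ suc n *_) (sym (det-laplace n A)) ⟩
      c ^ suc n * det (suc n) A
    ∎
    where
    open ≡-Reasoning
    regroup : ∀ s c a p d → s * (c * a) * (p * d) ≡ (c * p) * (s * a * d)
    regroup = solve-∀

  det-additive : ∀ n (M N P : Matrix n) (r : Fin n) →
    (∀ c → P r c ≡ M r c + N r c) →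
    (∀ x c → x ≢ r → M x c ≡ P x c) → (∀ x c → x ≢ r → N x c ≡ P x c) →
    det n P ≡ det n M + det n N
  det-additive (suc n) M N P r onRow offRowM offRowN = begin
      det (suc n) P
    ≡⟨ det-laplace n P ⟩
      sum (laplaceTerm P)
    ≡⟨ sum-cong-≗ (termwise r onRow offRowM offRowN) ⟩
      sum (λ j → laplaceTerm M j + laplaceTerm N j)
    ≡⟨ ∑-distrib-+ (laplaceTerm M) (laplaceTerm N) ⟩
      sum (laplaceTerm M) + sum (laplaceTerm N)
    ≡⟨ sym (cong₂ _+_ (det-laplace n M) (det-laplace n N)) ⟩
      det (suc n) M + det (suc n) N
    ∎
    where
    open ≡-Reasoning
    -- Each Laplace term is additive: for r = 0 the minors of M, N, P coincide;
    -- otherwise the entries in row 0 coincide and the minors are additive in row r - 1.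
    termwise : ∀ r → (∀ c → P r c ≡ M r c + N r c) →
      (∀ x c → x ≢ r → M x c ≡ P x c) → (∀ x c → x ≢ r → N x c ≡ P x c) →
      ∀ j → laplaceTerm P j ≡ laplaceTerm M j + laplaceTerm N j
    termwise zero onRow offRowM offRowN j = begin
        s * P zero j * det n (minor P j)
      ≡⟨ cong₂ (λ x d → s * x * d) (onRow j)
               (sym (det-cong n (λ x c → offRowM (suc x) (punchIn j c) λ ()))) ⟩
        s * (M zero j + N zero j) * det n (minor M j)
      ≡⟨ distrib s (M zero j) (N zero j) (det n (minor M j)) ⟩
        s * M zero j * det n (minor M j) + s * N zero j * det n (minor M j)
      ≡⟨ cong (λ d → s * M zero j * det n (minor M j) + s * N zero j * d)
              (det-cong n (λ x c → trans (offRowM (suc x) (punchIn j c) λ ())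
                                         (sym (offRowN (suc x) (punchIn j c) λ ())))) ⟩
        s * M zero j * det n (minor M j) + s * N zero j * det n (minor N j)
      ∎
      where
      s = altSign (toℕ j)
      distrib : ∀ s a b d → s * (a + b) * d ≡ s * a * d + s * b * d
      distrib = solve-∀
    termwise (suc r) onRow offRowM offRowN j = begin
        s * P zero j * det n (minor P j)
      ≡⟨ cong (s * P zero j *_) (det-additive n (minor M j) (minor N j) (minor P j) r
              (λ c → onRow (punchIn j c))
              (λ x c x≢r → offRowM (suc x) (punchIn j c) (x≢r ∘ FinP.suc-injective))
              (λ x c x≢r → offRowN (suc x) (punchIn j c) (x≢r ∘ FinP.suc-injective))) ⟩
        s * P zero j * (det n (minor M j) + det n (minor N j))
      ≡⟨ ℤP.*-distribˡ-+ (s * P zero j) (det n (minor M j)) (det n (minor N j)) ⟩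
        s * P zero j * det n (minor M j) + s * P zero j * det n (minor N j)
      ≡⟨ sym (cong₂ (λ a b → s * a * det n (minor M j) + s * b * det n (minor N j))
                    (offRowM zero j λ ()) (offRowN zero j λ ())) ⟩
        s * M zero j * det n (minor M j) + s * N zero j * det n (minor N j)
      ∎
      where
      s = altSign (toℕ j)

  swapTopRows : ∀ {n} → Matrix (suc (suc n)) → Matrix (suc (suc n))
  swapTopRows M zero          = M (suc zero)
  swapTopRows M (suc zero)    = M zero
  swapTopRows M (suc (suc r)) = M (suc (suc r))

  altSign-suc : ∀ k → altSign (suc k) ≡ - altSign k
  altSign-suc zero          = refl
  altSign-suc (suc zero)    = refl
  altSign-suc (suc (suc k)) = altSign-suc k

  -- Choosing column punchIn j k for row 0 and
  -- then column j for row 1 (at position punchOut in the minor) carries the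
  -- opposite sign to choosing column j for row 0 and then position k for row 1.
  altSign-punch : ∀ {m} (j : Fin (suc m)) (k : Fin m) (k≢j : punchIn j k ≢ j) →
    altSign (toℕ (punchIn j k)) * altSign (toℕ (punchOut k≢j))
    ≡ - (altSign (toℕ j) * altSign (toℕ k))
  altSign-punch {suc m} zero    k       _ rewrite altSign-suc (toℕ k) = rule (altSign (toℕ k))
    where
    rule : ∀ x → - x * + 1 ≡ - (+ 1 * x)
    rule = solve-∀
  altSign-punch {suc m} (suc j) zero    _ rewrite altSign-suc (toℕ j) = rule (altSign (toℕ j))
    where
    rule : ∀ x → + 1 * x ≡ - (- x * + 1)
    rule = solve-∀
  altSign-punch {suc m} (suc j) (suc k) k≢j = begin
      altSign (suc (toℕ (punchIn j k))) * altSign (suc (toℕ (punchOut k≢j′)))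
    ≡⟨ cong₂ _*_ (altSign-suc (toℕ (punchIn j k))) (altSign-suc (toℕ (punchOut k≢j′))) ⟩
      - altSign (toℕ (punchIn j k)) * - altSign (toℕ (punchOut k≢j′))
    ≡⟨ neg*neg (altSign (toℕ (punchIn j k))) (altSign (toℕ (punchOut k≢j′))) ⟩
      altSign (toℕ (punchIn j k)) * altSign (toℕ (punchOut k≢j′))
    ≡⟨ altSign-punch j k k≢j′ ⟩
      - (altSign (toℕ j) * altSign (toℕ k))
    ≡⟨ cong -_ (sym (neg*neg (altSign (toℕ j)) (altSign (toℕ k)))) ⟩
      - (- altSign (toℕ j) * - altSign (toℕ k))
    ≡⟨ cong -_ (sym (cong₂ _*_ (altSign-suc (toℕ j)) (altSign-suc (toℕ k)))) ⟩
      - (altSign (suc (toℕ j)) * altSign (suc (toℕ k)))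
    ∎
    where
    open ≡-Reasoning
    k≢j′ : punchIn j k ≢ j
    k≢j′ = k≢j ∘ cong suc
    neg*neg : ∀ x y → - x * - y ≡ x * y
    neg*neg = solve-∀

  -- Removing column punchIn j k and then (in the minor) the position of column j
  -- removes the same pair of columns as removing j and then position k.
  punchIn-pair-swap : ∀ {m} (j : Fin (suc (suc m))) (k : Fin (suc m)) (k≢j : punchIn j k ≢ j)
    (c : Fin m) →
    punchIn (punchIn j k) (punchIn (punchOut k≢j) c) ≡ punchIn j (punchIn k c)
  punchIn-pair-swap zero    k       _ c = refl
  punchIn-pair-swap (suc j) zero    _ c = refl
  punchIn-pair-swap {suc m} (suc j) (suc k) _   zero    = refl
  punchIn-pair-swap {suc m} (suc j) (suc k) k≢j (suc c) =
    cong suc (punchIn-pair-swap j k (k≢j ∘ cong suc) c)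

  -- The term of the double expansion along rows 0 and 1 in which row 0 uses
  -- column j and row 1 uses column punchIn j k.
  pairTerm : ∀ {n} → Matrix (suc (suc n)) → Fin (suc (suc n)) → Fin (suc n) → ℤ
  pairTerm M j k = altSign (toℕ j) * M zero j * laplaceTerm (minor M j) k

  det-double-laplace : ∀ n (M : Matrix (suc (suc n))) →
    det (suc (suc n)) M ≡ sum (λ j → sum (λ k → pairTerm M j k))
  det-double-laplace n M = trans (det-laplace (suc n) M) (sum-cong-≗ λ j →
    trans (cong (altSign (toℕ j) * M zero j *_) (det-laplace n (minor M j)))
          (*-distribˡ-sum (altSign (toℕ j) * M zero j) (laplaceTerm (minor M j))))

  -- pairTerm indexed by the two columns a (row 0) and b (row 1) themselves;
  -- there is no such term when a = b.
  columnPairTerm : ∀ {n} → Matrix (suc (suc n)) → (a b : Fin (suc (suc n))) → ℤ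
  columnPairTerm M a b with a ≟ b
  ... | yes _   = + 0
  ... | no  a≢b = pairTerm M a (punchOut a≢b)

  columnPairTerm-rowCol : ∀ {n} (M : Matrix (suc (suc n))) j k →
    columnPairTerm M j (punchIn j k) ≡ pairTerm M j k
  columnPairTerm-rowCol M j k with j ≟ punchIn j k
  ... | yes j≡ = ⊥-elim (FinP.punchInᵢ≢i j k (sym j≡))
  ... | no  j≢ = cong (pairTerm M j) (trans (FinP.punchOut-cong j refl) (FinP.punchOut-punchIn j))

  columnPairTerm-colRow : ∀ {n} (M : Matrix (suc (suc n))) j k →
    columnPairTerm M (punchIn j k) j ≡ - pairTerm (swapTopRows M) j k
  columnPairTerm-colRow {n} M j k with punchIn j k ≟ j
  ... | yes k≡j = ⊥-elim (FinP.punchInᵢ≢i j k k≡j)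
  ... | no  k≢j = begin
      (sa * M zero a) * ((sb * M (suc zero) (punchIn a b)) * det n (minor (minor M a) b))
    ≡⟨ cong₂ (λ c d → (sa * M zero a) * ((sb * M (suc zero) c) * d))
             (FinP.punchIn-punchOut k≢j)
             (det-cong n (λ r c → cong (M (suc (suc r))) (punchIn-pair-swap j k k≢j c))) ⟩
      (sa * M zero a) * ((sb * M (suc zero) j) * D)
    ≡⟨ antisymmetric sa sb (M zero a) (M (suc zero) j) D (altSign-punch j k k≢j) ⟩
      - ((sj * M (suc zero) j) * ((sk * M zero a) * D))
    ∎
    where
    open ≡-Reasoning
    a  = punchIn j k
    b  = punchOut k≢j
    sa = altSign (toℕ a)
    sb = altSign (toℕ b)
    sj = altSign (toℕ j)
    sk = altSign (toℕ k)
    D  = det n (λ r c → M (suc (suc r)) (punchIn j (punchIn k c)))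
    antisymmetric : ∀ sa sb x y d → sa * sb ≡ - (sj * sk) →
      (sa * x) * ((sb * y) * d) ≡ - ((sj * y) * ((sk * x) * d))
    antisymmetric sa sb x y d signs = begin
        (sa * x) * ((sb * y) * d) ≡⟨ regroupˡ sa sb x y d ⟩
        (sa * sb) * (x * y * d)   ≡⟨ cong (_* (x * y * d)) signs ⟩
        - (sj * sk) * (x * y * d) ≡⟨ regroupʳ sj sk x y d ⟩
        - ((sj * y) * ((sk * x) * d)) ∎
      where
      regroupˡ : ∀ sa sb x y d → (sa * x) * ((sb * y) * d) ≡ (sa * sb) * (x * y * d)
      regroupˡ = solve-∀
      regroupʳ : ∀ sj sk x y d → - (sj * sk) * (x * y * d) ≡ - ((sj * y) * ((sk * x) * d))
      regroupʳ = solve-∀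

  det-swapTopRows : ∀ n (M : Matrix (suc (suc n))) →
    det (suc (suc n)) M ≡ - det (suc (suc n)) (swapTopRows M)
  det-swapTopRows n M = begin
      det (suc (suc n)) M
    ≡⟨ det-double-laplace n M ⟩
      sum (λ j → sum (λ k → pairTerm M j k))
    ≡⟨ sum-cong-≗ (λ j → sum-cong-≗ (λ k → sym (columnPairTerm-rowCol M j k))) ⟩
      sum (λ j → sum (λ k → columnPairTerm M j (punchIn j k)))
    ≡⟨ sum-offDiagonal-transpose (suc n) (columnPairTerm M) ⟩
      sum (λ j → sum (λ k → columnPairTerm M (punchIn j k) j))
    ≡⟨ sum-cong-≗ (λ j → sum-cong-≗ (λ k → columnPairTerm-colRow M j k)) ⟩
      sum (λ j → sum (λ k → - pairTerm (swapTopRows M) j k))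
    ≡⟨ sum-cong-≗ (λ j → sum-neg (pairTerm (swapTopRows M) j)) ⟩
      sum (λ j → - sum (λ k → pairTerm (swapTopRows M) j k))
    ≡⟨ sum-neg (λ j → sum (λ k → pairTerm (swapTopRows M) j k)) ⟩
      - sum (λ j → sum (λ k → pairTerm (swapTopRows M) j k))
    ≡⟨ cong -_ (sym (det-double-laplace n (swapTopRows M))) ⟩
      - det (suc (suc n)) (swapTopRows M)
    ∎
    where open ≡-Reasoning

  x≡-x⇒x≡0 : ∀ x → x ≡ - x → x ≡ + 0
  x≡-x⇒x≡0 (+ zero)  _  = refl
  x≡-x⇒x≡0 (+ suc n) ()
  x≡-x⇒x≡0 -[1+ n ]  ()

  -- If neither row is row 0,
  -- every minor has two equal rows; if one of them is row 0, swapping the first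
  -- two rows reduces to that case (or, for rows 0 and 1, gives det M = - det M).
  det-equalRows : ∀ n (M : Matrix n) (i j : Fin n) → i ≢ j →
    (∀ c → M i c ≡ M j c) → det n M ≡ + 0
  det-equalRows-below : ∀ n (M : Matrix (suc n)) (i j : Fin n) → i ≢ j →
    (∀ c → M (suc i) c ≡ M (suc j) c) → det (suc n) M ≡ + 0
  det-equalRows-top : ∀ n (M : Matrix (suc n)) (j : Fin n) →
    (∀ c → M zero c ≡ M (suc j) c) → det (suc n) M ≡ + 0

  det-equalRows-below n M i j i≢j equal = trans (det-laplace n M) (sum-zero (suc n) λ k →
    trans (cong (altSign (toℕ k) * M zero k *_)
                (det-equalRows n (minor M k) i j i≢j (λ c → equal (punchIn k c))))
          (ℤP.*-zeroʳ (altSign (toℕ k) * M zero k)))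

  det-equalRows-top (suc n) M zero equal = x≡-x⇒x≡0 (det (suc (suc n)) M)
    (trans (det-swapTopRows n M) (cong -_ (det-cong (suc (suc n)) swapped≗M)))
    where
    swapped≗M : ∀ r c → swapTopRows M r c ≡ M r c
    swapped≗M zero          c = sym (equal c)
    swapped≗M (suc zero)    c = equal c
    swapped≗M (suc (suc r)) c = refl
  det-equalRows-top (suc n) M (suc j) equal =
    trans (det-swapTopRows n M)
          (cong -_ (det-equalRows-below (suc n) (swapTopRows M) zero (suc j) (λ ()) equal))

  det-equalRows (suc n) M zero    zero    i≢j equal = ⊥-elim (i≢j refl)
  det-equalRows (suc n) M zero    (suc j) i≢j equal = det-equalRows-top n M j equal
  det-equalRows (suc n) M (suc i) zero    i≢j equal = det-equalRows-top n M i (sym ∘ equal)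
  det-equalRows (suc n) M (suc i) (suc j) i≢j equal =
    det-equalRows-below n M i j (i≢j ∘ cong suc) equal

  copyRow : ∀ {n} → Matrix n → (r s : Fin n) → Matrix n
  copyRow M r s x c with x ≟ r
  ... | yes _ = M s c
  ... | no  _ = M x c

  copyRow-on : ∀ {n} (M : Matrix n) r s c → copyRow M r s r c ≡ M s c
  copyRow-on M r s c with r ≟ r
  ... | yes _   = refl
  ... | no  r≢r = ⊥-elim (r≢r refl)

  copyRow-off : ∀ {n} (M : Matrix n) r s x c → x ≢ r → copyRow M r s x c ≡ M x c
  copyRow-off M r s x c x≢r with x ≟ r
  ... | yes x≡r = ⊥-elim (x≢r x≡r)
  ... | no  _   = refl

  -- Adding row s to a different row r leaves the determinant unchanged:
  -- by additivity the change is the determinant of a matrix with two equal rows.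
  det-addRow : ∀ n (M P : Matrix n) (r s : Fin n) → r ≢ s →
    (∀ c → P r c ≡ M r c + M s c) → (∀ x c → x ≢ r → P x c ≡ M x c) → det n P ≡ det n M
  det-addRow n M P r s r≢s onRow offRow = begin
      det n P
    ≡⟨ det-additive n M (copyRow M r s) P r
         (λ c → trans (onRow c) (cong (_+_ (M r c)) (sym (copyRow-on M r s c))))
         (λ x c x≢r → sym (offRow x c x≢r))
         (λ x c x≢r → trans (copyRow-off M r s x c x≢r) (sym (offRow x c x≢r))) ⟩
      det n M + det n (copyRow M r s)
    ≡⟨ cong (_+_ (det n M)) (det-equalRows n (copyRow M r s) r s r≢s λ c →
         trans (copyRow-on M r s c) (sym (copyRow-off M r s s c (r≢s ∘ sym)))) ⟩
      det n M + + 0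
    ≡⟨ ℤP.+-identityʳ (det n M) ⟩
      det n M
    ∎
    where open ≡-Reasoning

  addRowsBelow : ∀ {n} → ℕ → (Fin n → Fin n) → Matrix n → Matrix n
  addRowsBelow t source H r c = if does (toℕ r ℕ.<? t) then H r c + H (source r) c else H r c

  addRowsBelow-in : ∀ {n} t source (H : Matrix n) r c → toℕ r ℕ.< t →
    addRowsBelow t source H r c ≡ H r c + H (source r) c
  addRowsBelow-in t source H r c r<t rewrite dec-true (toℕ r ℕ.<? t) r<t = refl

  addRowsBelow-out : ∀ {n} t source (H : Matrix n) r c → ¬ toℕ r ℕ.< t →
    addRowsBelow t source H r c ≡ H r c
  addRowsBelow-out t source H r c r≮t rewrite dec-false (toℕ r ℕ.<? t) r≮t = refl

  -- One more row addition: if the source rows all have index > t, then passing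
  -- from t to t + 1 adds the (still unmodified) row 'source r₀' to row r₀ = t.
  det-addRowsBelow-step : ∀ n (H : Matrix n) (source : Fin n → Fin n) t → t ℕ.< n →
    (∀ r → t ℕ.< toℕ (source r)) →
    det n (addRowsBelow (suc t) source H) ≡ det n (addRowsBelow t source H)
  det-addRowsBelow-step n H source t t<n t<source =
    det-addRow n (addRowsBelow t source H) (addRowsBelow (suc t) source H) r₀ (source r₀)
               r₀≢source onRow offRow
    where
    r₀ : Fin n
    r₀ = fromℕ< t<n
    r₀≡t : toℕ r₀ ≡ t
    r₀≡t = FinP.toℕ-fromℕ< t<n
    r₀≢source : r₀ ≢ source r₀
    r₀≢source r₀≡ = ℕP.<-irrefl (trans (sym r₀≡t) (cong toℕ r₀≡)) (t<source r₀)
    onRow : ∀ c → addRowsBelow (suc t) source H r₀ c ≡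
                  addRowsBelow t source H r₀ c + addRowsBelow t source H (source r₀) c
    onRow c = begin
        addRowsBelow (suc t) source H r₀ c
      ≡⟨ addRowsBelow-in (suc t) source H r₀ c (ℕP.≤-reflexive (cong suc r₀≡t)) ⟩
        H r₀ c + H (source r₀) c
      ≡⟨ sym (cong₂ _+_ (addRowsBelow-out t source H r₀ c (ℕP.<-irrefl r₀≡t))
                        (addRowsBelow-out t source H (source r₀) c (ℕP.<-asym (t<source r₀)))) ⟩
        addRowsBelow t source H r₀ c + addRowsBelow t source H (source r₀) c
      ∎
      where open ≡-Reasoning
    offRow : ∀ x c → x ≢ r₀ → addRowsBelow (suc t) source H x c ≡ addRowsBelow t source H x c
    offRow x c x≢r₀ with toℕ x ℕ.<? t
    ... | yes x<t = trans (addRowsBelow-in (suc t) source H x c (ℕP.m<n⇒m<1+n x<t))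
                          (sym (addRowsBelow-in t source H x c x<t))
    ... | no  x≮t = trans (addRowsBelow-out (suc t) source H x c x≮1+t)
                          (sym (addRowsBelow-out t source H x c x≮t))
      where
      x≮1+t : ¬ toℕ x ℕ.< suc t
      x≮1+t x<1+t with ℕP.m<1+n⇒m<n∨m≡n x<1+t
      ... | inj₁ x<t = x≮t x<t
      ... | inj₂ x≡t = x≢r₀ (FinP.toℕ-injective (trans x≡t (sym r₀≡t)))

  det-addRowsBelow : ∀ n (H : Matrix n) (source : Fin n → Fin n) m → m ℕ.≤ n →
    (∀ r → m ℕ.≤ toℕ (source r)) →
    ∀ t → t ℕ.≤ m → det n (addRowsBelow t source H) ≡ det n H
  det-addRowsBelow n H source m m≤n sourceHigh zero    _   =
    det-cong n (λ r c → addRowsBelow-out 0 source H r c λ ())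
  det-addRowsBelow n H source m m≤n sourceHigh (suc t) t<m =
    trans (det-addRowsBelow-step n H source t (ℕP.<-≤-trans t<m m≤n)
                                 (λ r → ℕP.<-≤-trans t<m (sourceHigh r)))
          (det-addRowsBelow n H source m m≤n sourceHigh t (ℕP.<⇒≤ t<m))

  punchIn-↑ˡ : ∀ {a} b (x : Fin (suc a)) (j : Fin a) →
    punchIn (x ↑ˡ b) (j ↑ˡ b) ≡ punchIn x j ↑ˡ b
  punchIn-↑ˡ b zero    j       = refl
  punchIn-↑ˡ b (suc x) zero    = refl
  punchIn-↑ˡ b (suc x) (suc j) = cong suc (punchIn-↑ˡ b x j)

  punchIn-↑ʳ : ∀ {a} b (x : Fin (suc a)) (j : Fin b) →
    punchIn (x ↑ˡ b) (a ↑ʳ j) ≡ suc a ↑ʳ j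
  punchIn-↑ʳ         b zero    j = refl
  punchIn-↑ʳ {suc a} b (suc x) j = cong suc (punchIn-↑ʳ b x j)

  sum-↑ : ∀ a b (f : Fin (a ℕ.+ b) → ℤ) →
    sum f ≡ sum (λ i → f (i ↑ˡ b)) + sum (λ j → f (a ↑ʳ j))
  sum-↑ zero    b f = sym (ℤP.+-identityˡ (sum f))
  sum-↑ (suc a) b f = trans (cong (_+_ (f zero)) (sum-↑ a b (λ i → f (suc i))))
                            (sym (ℤP.+-assoc (f zero) _ _))

  -- Induction on the size of the
  -- top-left block: expanding along row 0, the terms of the right block vanish
  -- and each remaining minor is again block lower-triangular.
  det-blockLower : ∀ a b (M : Matrix (a ℕ.+ b)) → (∀ i j → M (i ↑ˡ b) (a ↑ʳ j) ≡ + 0) →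
    det (a ℕ.+ b) M
    ≡ det a (λ i j → M (i ↑ˡ b) (j ↑ˡ b)) * det b (λ i j → M (a ↑ʳ i) (a ↑ʳ j))
  det-blockLower zero    b M _       = sym (ℤP.*-identityˡ (det b M))
  det-blockLower (suc a) b M topRight0 = begin
      det (suc a ℕ.+ b) M
    ≡⟨ det-laplace (a ℕ.+ b) M ⟩
      sum (laplaceTerm M)
    ≡⟨ sum-↑ (suc a) b (laplaceTerm M) ⟩
      sum (λ x → laplaceTerm M (x ↑ˡ b)) + sum (λ j → laplaceTerm M (suc a ↑ʳ j))
    ≡⟨ cong₂ _+_ (sum-cong-≗ leftTerm) (sum-zero b rightTerm) ⟩
      sum (λ x → laplaceTerm TL x * det b BR) + + 0
    ≡⟨ ℤP.+-identityʳ _ ⟩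
      sum (λ x → laplaceTerm TL x * det b BR)
    ≡⟨ sym (*-distribʳ-sum (det b BR) (laplaceTerm TL)) ⟩
      sum (laplaceTerm TL) * det b BR
    ≡⟨ cong (_* det b BR) (sym (det-laplace a TL)) ⟩
      det (suc a) TL * det b BR
    ∎
    where
    open ≡-Reasoning
    TL : Matrix (suc a)
    TL i j = M (i ↑ˡ b) (j ↑ˡ b)
    BR : Matrix b
    BR i j = M (suc a ↑ʳ i) (suc a ↑ʳ j)
    rightTerm : ∀ j → laplaceTerm M (suc a ↑ʳ j) ≡ + 0
    rightTerm j = trans (cong (λ x → s * x * d) (topRight0 zero j)) (vanish s d)
      where
      s = altSign (toℕ (suc a ↑ʳ j))
      d = det (a ℕ.+ b) (minor M (suc a ↑ʳ j))
      vanish : ∀ s d → s * + 0 * d ≡ + 0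
      vanish = solve-∀
    minor-det : ∀ x → det (a ℕ.+ b) (minor M (x ↑ˡ b)) ≡ det a (minor TL x) * det b BR
    minor-det x = trans
      (det-blockLower a b (minor M (x ↑ˡ b))
        (λ i j → trans (cong (M (suc (i ↑ˡ b))) (punchIn-↑ʳ b x j)) (topRight0 (suc i) j)))
      (cong₂ _*_ (det-cong a (λ i j → cong (M (suc (i ↑ˡ b))) (punchIn-↑ˡ b x j)))
                 (det-cong b (λ i j → cong (M (suc a ↑ʳ i)) (punchIn-↑ʳ b x j))))
    leftTerm : ∀ x → laplaceTerm M (x ↑ˡ b) ≡ laplaceTerm TL x * det b BR
    leftTerm x = begin
        altSign (toℕ (x ↑ˡ b)) * TL zero x * det (a ℕ.+ b) (minor M (x ↑ˡ b))
      ≡⟨ cong₂ (λ k d → altSign k * TL zero x * d) (FinP.toℕ-↑ˡ x b) (minor-det x) ⟩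
        altSign (toℕ x) * TL zero x * (det a (minor TL x) * det b BR)
      ≡⟨ sym (ℤP.*-assoc (altSign (toℕ x) * TL zero x) (det a (minor TL x)) (det b BR)) ⟩
        laplaceTerm TL x * det b BR
      ∎

  doublingEntry : ∀ {m} → Matrix m → Fin m ⊎ Fin m → Fin m ⊎ Fin m → ℤ
  doublingEntry A (inj₁ i) (inj₁ j) = A i j
  doublingEntry A (inj₁ i) (inj₂ j) = A i j
  doublingEntry A (inj₂ i) (inj₁ j) = A i j
  doublingEntry A (inj₂ i) (inj₂ j) = - A i j

  sylvesterDouble : ∀ {m} → Matrix m → Matrix (m ℕ.+ m)
  sylvesterDouble {m} A r c = doublingEntry A (splitAt m r) (splitAt m c)

  -- det [[A, A], [A, -A]] = det (2A) * det (-A): adding each bottom row to the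
  -- corresponding top row gives the block lower-triangular [[2A, 0], [A, -A]].
  det-sylvesterDouble : ∀ m (A : Matrix m) →
    det (m ℕ.+ m) (sylvesterDouble A) ≡ ((+ 2) ^ m * det m A) * (-1ℤ ^ m * det m A)
  det-sylvesterDouble m A = begin
      det (m ℕ.+ m) H
    ≡⟨ sym (det-addRowsBelow (m ℕ.+ m) H partner m (ℕP.m≤m+n m m) partner-high m ℕP.≤-refl) ⟩
      det (m ℕ.+ m) R
    ≡⟨ det-blockLower m m R topRight0 ⟩
      det m (λ i j → R (i ↑ˡ m) (j ↑ˡ m)) * det m (λ i j → R (m ↑ʳ i) (m ↑ʳ j))
    ≡⟨ cong₂ _*_ (trans (det-cong m topLeft) (det-scale m (+ 2) A))
                 (trans (det-cong m bottomRight) (det-scale m -1ℤ A)) ⟩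
      ((+ 2) ^ m * det m A) * (-1ℤ ^ m * det m A)
    ∎
    where
    open ≡-Reasoning
    H = sylvesterDouble A
    partner : Fin (m ℕ.+ m) → Fin (m ℕ.+ m)
    partner r = m ↑ʳ [ id , id ]′ (splitAt m r)
    partner-high : ∀ r → m ℕ.≤ toℕ (partner r)
    partner-high r = ℕP.≤-trans (ℕP.m≤m+n m _) (ℕP.≤-reflexive (sym (FinP.toℕ-↑ʳ m _)))
    R = addRowsBelow m partner H
    H-join : ∀ u v → H (join m m u) (join m m v) ≡ doublingEntry A u v
    H-join u v rewrite FinP.splitAt-join m m u | FinP.splitAt-join m m v = refl
    top : ∀ i c → R (i ↑ˡ m) c ≡ H (i ↑ˡ m) c + H (m ↑ʳ i) c
    top i c = trans
      (addRowsBelow-in m partner H (i ↑ˡ m) c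
                       (subst (ℕ._< m) (sym (FinP.toℕ-↑ˡ i m)) (FinP.toℕ<n i)))
      (cong (λ r → H (i ↑ˡ m) c + H r c) partner-top)
      where
      partner-top : partner (i ↑ˡ m) ≡ m ↑ʳ i
      partner-top rewrite FinP.splitAt-↑ˡ m i m = refl
    bottom : ∀ i c → R (m ↑ʳ i) c ≡ H (m ↑ʳ i) c
    bottom i c = addRowsBelow-out m partner H (m ↑ʳ i) c
      (ℕP.≤⇒≯ (ℕP.≤-trans (ℕP.m≤m+n m (toℕ i))
                          (ℕP.≤-reflexive (sym (FinP.toℕ-↑ʳ m i)))))
    topRight0 : ∀ i j → R (i ↑ˡ m) (m ↑ʳ j) ≡ + 0
    topRight0 i j = trans (top i (m ↑ʳ j))
      (trans (cong₂ _+_ (H-join (inj₁ i) (inj₂ j)) (H-join (inj₂ i) (inj₂ j)))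
             (ℤP.+-inverseʳ (A i j)))
    topLeft : ∀ i j → R (i ↑ˡ m) (j ↑ˡ m) ≡ + 2 * A i j
    topLeft i j = trans (top i (j ↑ˡ m))
      (trans (cong₂ _+_ (H-join (inj₁ i) (inj₁ j)) (H-join (inj₂ i) (inj₁ j))) (double (A i j)))
      where
      double : ∀ x → x + x ≡ + 2 * x
      double = solve-∀
    bottomRight : ∀ i j → R (m ↑ʳ i) (m ↑ʳ j) ≡ -1ℤ * A i j
    bottomRight i j = trans (bottom i (m ↑ʳ j))
      (trans (H-join (inj₂ i) (inj₂ j)) (sym (ℤP.-1*i≡-i (A i j))))

  ∣i^n∣≡∣i∣^n : ∀ i n → ∣ i ^ n ∣ ≡ ∣ i ∣ ℕ.^ n
  ∣i^n∣≡∣i∣^n i zero    = refl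
  ∣i^n∣≡∣i∣^n i (suc n) =
    trans (ℤP.abs-* i (i ^ n)) (cong (∣ i ∣ ℕ.*_) (∣i^n∣≡∣i∣^n i n))

  [m*n]^o≡m^o*n^o : ∀ m n o → (m ℕ.* n) ℕ.^ o ≡ m ℕ.^ o ℕ.* n ℕ.^ o
  [m*n]^o≡m^o*n^o m n zero    = refl
  [m*n]^o≡m^o*n^o m n (suc o) = trans (cong ((m ℕ.* n) ℕ.*_) ([m*n]^o≡m^o*n^o m n o))
                                      (interchange m n (m ℕ.^ o) (n ℕ.^ o))
    where
    interchange : ∀ a b c d → a ℕ.* b ℕ.* (c ℕ.* d) ≡ a ℕ.* c ℕ.* (b ℕ.* d)
    interchange = ℕS.solve-∀

  IsSign : ℤ → Set
  IsSign x = (x ≡ + 1) ⊎ (x ≡ -[1+ 0 ])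

  doublingEntry-sign : ∀ {m} (A : Matrix m) → (∀ i j → IsSign (A i j)) →
    ∀ u v → IsSign (doublingEntry A u v)
  doublingEntry-sign A signs (inj₁ i) (inj₁ j) = signs i j
  doublingEntry-sign A signs (inj₁ i) (inj₂ j) = signs i j
  doublingEntry-sign A signs (inj₂ i) (inj₁ j) = signs i j
  doublingEntry-sign A signs (inj₂ i) (inj₂ j) with signs i j
  ... | inj₁ A≡1  = inj₂ (cong -_ A≡1)
  ... | inj₂ A≡-1 = inj₁ (cong -_ A≡-1)

  -- Sylvester doubling preserves the Hadamard property: the entries stay ±1, and
  -- |det| = 2^m |det A|² = 2^m m^m = (2m)^m, whose square is (2m)^(2m).
  sylvesterDouble-hadamard : ∀ m (A : Matrix m) → IsHadamardMatrix m A →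
    IsHadamardMatrix (m ℕ.+ m) (sylvesterDouble A)
  sylvesterDouble-hadamard m A (signs , detSquare) =
    (λ r c → doublingEntry-sign A signs (splitAt m r) (splitAt m c)) , doubledDetSquare
    where
    open ≡-Reasoning
    d = det m A
    D = ∣ d ∣
    H = sylvesterDouble A
    absDet : ∣ det (m ℕ.+ m) H ∣ ≡ 2 ℕ.^ m ℕ.* (D ℕ.* D)
    absDet = begin
        ∣ det (m ℕ.+ m) H ∣
      ≡⟨ cong ∣_∣ (det-sylvesterDouble m A) ⟩
        ∣ ((+ 2) ^ m * d) * (-1ℤ ^ m * d) ∣
      ≡⟨ ℤP.abs-* ((+ 2) ^ m * d) (-1ℤ ^ m * d) ⟩
        ∣ (+ 2) ^ m * d ∣ ℕ.* ∣ -1ℤ ^ m * d ∣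
      ≡⟨ cong₂ ℕ._*_ (ℤP.abs-* ((+ 2) ^ m) d) (ℤP.abs-* (-1ℤ ^ m) d) ⟩
        ∣ (+ 2) ^ m ∣ ℕ.* D ℕ.* (∣ -1ℤ ^ m ∣ ℕ.* D)
      ≡⟨ cong₂ (λ a b → a ℕ.* D ℕ.* (b ℕ.* D)) (∣i^n∣≡∣i∣^n (+ 2) m)
                                              (trans (∣i^n∣≡∣i∣^n -1ℤ m) (ℕP.^-zeroˡ m)) ⟩
        2 ℕ.^ m ℕ.* D ℕ.* (1 ℕ.* D)
      ≡⟨ regroup (2 ℕ.^ m) D ⟩
        2 ℕ.^ m ℕ.* (D ℕ.* D)
      ∎
      where
      regroup : ∀ a D → a ℕ.* D ℕ.* (1 ℕ.* D) ≡ a ℕ.* (D ℕ.* D)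
      regroup = ℕS.solve-∀
    doubledDetSquare : ∣ det (m ℕ.+ m) H ∣ ℕ.* ∣ det (m ℕ.+ m) H ∣ ≡ (m ℕ.+ m) ℕ.^ (m ℕ.+ m)
    doubledDetSquare = begin
        ∣ det (m ℕ.+ m) H ∣ ℕ.* ∣ det (m ℕ.+ m) H ∣
      ≡⟨ cong (λ x → x ℕ.* x) (trans absDet (cong (2 ℕ.^ m ℕ.*_) detSquare)) ⟩
        (2 ℕ.^ m ℕ.* m ℕ.^ m) ℕ.* (2 ℕ.^ m ℕ.* m ℕ.^ m)
      ≡⟨ cong (λ x → x ℕ.* x) (sym ([m*n]^o≡m^o*n^o 2 m m)) ⟩
        (2 ℕ.* m) ℕ.^ m ℕ.* (2 ℕ.* m) ℕ.^ m
      ≡⟨ cong (λ x → x ℕ.^ m ℕ.* x ℕ.^ m) (cong (m ℕ.+_) (ℕP.+-identityʳ m)) ⟩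
        (m ℕ.+ m) ℕ.^ m ℕ.* (m ℕ.+ m) ℕ.^ m
      ≡⟨ sym (ℕP.^-distribˡ-+-* (m ℕ.+ m) m m) ⟩
        (m ℕ.+ m) ℕ.^ (m ℕ.+ m)
      ∎

  -- 2^k, computed by doubling so that Fin (pow2 (suc k)) is Fin (pow2 k + pow2 k).
  pow2 : ℕ → ℕ
  pow2 zero    = 1
  pow2 (suc k) = pow2 k ℕ.+ pow2 k

  pow2-positive : ∀ k → 1 ℕ.≤ pow2 k
  pow2-positive zero    = ℕP.≤-refl
  pow2-positive (suc k) = ℕP.≤-trans (pow2-positive k) (ℕP.m≤m+n (pow2 k) (pow2 k))

  sylvester : ∀ k → Matrix (pow2 k)
  sylvester zero    _ _ = + 1
  sylvester (suc k)     = sylvesterDouble (sylvester k)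

  sylvester-hadamard : ∀ k → IsHadamardMatrix (pow2 k) (sylvester k)
  sylvester-hadamard zero    = (λ _ _ → inj₁ refl) , refl
  sylvester-hadamard (suc k) = sylvesterDouble-hadamard (pow2 k) (sylvester k) (sylvester-hadamard k)

  pow2∈H : ∀ k → InH (pow2 k)
  pow2∈H k = pow2-positive k , sylvester k , sylvester-hadamard k

open SylvesterHadamard using (pow2; pow2-positive; pow2∈H)

open import Data.Nat using (ℕ; _≤_; _*_)
open import Data.Nat using (zero; suc; _+_; _<_; ∣_-_∣; _≤?_; s≤s; z≤n)
import Data.Nat.Properties as ℕP
open import Data.Nat.Tactic.RingSolver using (solve-∀)
open import Data.Product using (Σ; _×_; _,_)
open import Data.Sum using (_⊎_; inj₁; inj₂)
open import Relation.Nullary using (yes; no)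
open import Relation.Binary.PropositionalEquality using (_≡_; refl; sym; subst)

dyadic-interval : ∀ n → 1 ≤ n → Σ ℕ λ k → pow2 k ≤ n × n < pow2 k + pow2 k
dyadic-interval (suc zero)    _ = 0 , ℕP.≤-refl , ℕP.≤-refl
dyadic-interval (suc (suc n)) _ with dyadic-interval (suc n) (s≤s z≤n)
... | k , lower , upper with ℕP.m≤n⇒m<n∨m≡n upper
...   | inj₁ upper′ = k , ℕP.m≤n⇒m≤1+n lower , upper′
...   | inj₂ n≡2p   = suc k , ℕP.≤-reflexive (sym n≡2p) ,
          subst (_< pow2 (suc k) + pow2 (suc k)) (sym n≡2p)
                (ℕP.m<m+n (pow2 (suc k)) (pow2-positive (suc k)))

near-p : ∀ p t → t + t ≤ p → 3 * ∣ p + t - p ∣ ≤ p + t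
near-p p t 2t≤p rewrite ℕP.∣-∣-comm (p + t) p | ℕP.∣m-m+n∣≡n p t =
  subst (_≤ p + t) (triple t) (ℕP.+-monoˡ-≤ t 2t≤p)
  where
  triple : ∀ t → t + t + t ≡ 3 * t
  triple = solve-∀

-- n = p + t with t ≤ p ≤ 2t is within n/3 of 2p: writing p = t + u with u ≤ t,
-- the distance is u.
near-2p : ∀ p t → t ≤ p → p ≤ t + t → 3 * ∣ p + t - p + p ∣ ≤ p + t
near-2p p t t≤p p≤2t with ℕP.m≤n⇒∃[o]m+o≡n t≤p
... | u , refl rewrite ℕP.∣m+n-m+o∣≡∣n-o∣ (t + u) t (t + u) | ℕP.∣m-m+n∣≡n t u =
  subst (_≤ (t + u) + t) (triple u) (ℕP.+-mono-≤ (ℕP.+-mono-≤ u≤t (ℕP.≤-refl {u})) u≤t)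
  where
  u≤t : u ≤ t
  u≤t = ℕP.+-cancelˡ-≤ t u t p≤2t
  triple : ∀ u → u + u + u ≡ 3 * u
  triple = solve-∀

near-p-or-2p : ∀ p n → p ≤ n → n < p + p → 3 * ∣ n - p ∣ ≤ n ⊎ 3 * ∣ n - p + p ∣ ≤ n
near-p-or-2p p n p≤n n<2p with ℕP.m≤n⇒∃[o]m+o≡n p≤n
... | t , refl with t + t ≤? p
...   | yes 2t≤p = inj₁ (near-p p t 2t≤p)
...   | no  2t≰p = inj₂ (near-2p p t t≤p (ℕP.<⇒≤ (ℕP.≰⇒> 2t≰p)))
  where
  t≤p : t ≤ p
  t≤p = ℕP.<⇒≤ (ℕP.+-cancelˡ-< p t p n<2p)

δ-bound : ∀ n d → IsDelta n d → ∀ h → InH h → 3 * ∣ n - h ∣ ≤ n → 3 * d ≤ n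
δ-bound n d (_ , minimal) h h∈H near = ℕP.≤-trans (ℕP.*-monoʳ-≤ 3 (minimal h h∈H)) near

lemma5 : ∀ (n : ℕ) → 1 ≤ n → ∀ (d : ℕ) → IsDelta n d → 3 * d ≤ n
lemma5 n 1≤n d isδ with dyadic-interval n 1≤n
... | k , lower , upper with near-p-or-2p (pow2 k) n lower upper
...   | inj₁ nearP  = δ-bound n d isδ (pow2 k)       (pow2∈H k)       nearP
...   | inj₂ near2P = δ-bound n d isδ (pow2 (suc k)) (pow2∈H (suc k)) near2P
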